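{- Let $N$ be a positive integer and let $P$ be a polyomino of minimum size among polyominoes containing at least $N$ instances of the L tromino. Then $|S_c|\ge 1$, $|S_t|\ge1$ and $|S_r|\ge1$.
   Context: Cells are the unit squares of the square lattice, indexed by integer coordinates $(x,y)$ with $y$ increasing upward. A polyomino is a finite nonempty edge-connected set of cells; its size is its number of cells. The L tromino is $\{(0,0),(1,0),(0,1)\}$; in it, $(0,0)$ is the central cell, $(1,0)$ the right cell and $(0,1)$ the top cell; an instance is a translate of it, with central/right/top cells defined by translation. For $P$, let $X_t$ (resp. $X_r$, $X_c$) be the set of cells of $P$ which are the top (resp. right, central) cell of some instance of the L tromino contained in $P$. Define $S_t=X_t\setminus(X_r\cup X_c)$, $S_r=X_r\setminus(X_t\cup X_c)$, $S_c=X_c\setminus(X_t\cup X_r)$. -}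

module Defs where

open import Data.Nat using (ℕ; _≤_)
open import Data.Integer as ℤ using (ℤ; _+_; _-_; ∣_∣; 0ℤ; 1ℤ)
import Data.Integer.Properties as ℤP
open import Data.Product using (_×_; _,_)
open import Data.Product.Properties using (≡-dec)
open import Data.List using (List; []; length; filterᵇ)
open import Data.List.Relation.Unary.Unique.Propositional using (Unique)
open import Data.Bool using (Bool; _∧_; not)
open import Relation.Nullary using (¬_)
open import Relation.Nullary.Decidable using (⌊_⌋)
open import Relation.Binary.PropositionalEquality using (_≡_; _≢_)
open import Relation.Binary.Construct.Closure.ReflexiveTransitive using (Star)

-- A cell (x , y) of the square lattice, y increasing upward.
Cell : Set
Cell = ℤ × ℤ

open import Data.List.Membership.DecPropositional (≡-dec ℤP._≟_ ℤP._≟_)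
  using (_∈_; _∈?_) public

Adjacent : Cell → Cell → Set
Adjacent (x , y) (x' , y') = ∣ x - x' ∣ Data.Nat.+ ∣ y - y' ∣ ≡ 1

Step : List Cell → Cell → Cell → Set
Step cs a b = a ∈ cs × b ∈ cs × Adjacent a b

EdgeConnected : List Cell → Set
EdgeConnected cs = ∀ {a b} → a ∈ cs → b ∈ cs → Star (Step cs) a b

record Polyomino : Set where
  field
    cells     : List Cell
    unique    : Unique cells
    nonempty  : cells ≢ []
    connected : EdgeConnected cells
open Polyomino public

size : Polyomino → ℕ
size P = length (cells P)

infix 4 _∈ᵇ_
_∈ᵇ_ : Cell → List Cell → Bool
c ∈ᵇ cs = ⌊ c ∈? cs ⌋

-- Instance of the L tromino with central cell (x , y):
-- cells (x , y) [central], (x+1 , y) [right], (x , y+1) [top].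
-- c is the central cell of an instance contained in P.
isCentral : Polyomino → Cell → Bool
isCentral P (x , y) =
  ((x , y) ∈ᵇ cells P) ∧ ((x + 1ℤ , y) ∈ᵇ cells P) ∧ ((x , y + 1ℤ) ∈ᵇ cells P)

isRight : Polyomino → Cell → Bool
isRight P (x , y) = isCentral P (x - 1ℤ , y)

isTop : Polyomino → Cell → Bool
isTop P (x , y) = isCentral P (x , y - 1ℤ)

-- Instances are translates, determined by their central cell, so the number
-- of instances of the L tromino contained in P is the number of central cells.
instances : Polyomino → ℕ
instances P = length (filterᵇ (isCentral P) (cells P))

Xt Xr Xc : Polyomino → List Cell
Xt P = filterᵇ (isTop P) (cells P)
Xr P = filterᵇ (isRight P) (cells P)
Xc P = filterᵇ (isCentral P) (cells P)

St Sr Sc : Polyomino → List Cell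
St P = filterᵇ (λ c → isTop P c ∧ not (isRight P c) ∧ not (isCentral P c)) (cells P)
Sr P = filterᵇ (λ c → isRight P c ∧ not (isTop P c) ∧ not (isCentral P c)) (cells P)
Sc P = filterᵇ (λ c → isCentral P c ∧ not (isTop P c) ∧ not (isRight P c)) (cells P)

MinimalFor : ℕ → Polyomino → Set
MinimalFor N P = N ≤ instances P × (∀ (Q : Polyomino) → N ≤ instances Q → size P ≤ size Q)

{-# OPTIONS --safe #-}
module Submission where

-- A central cell
-- minimising x + y is neither a top nor a right cell: the central cell below
-- or to its left would have smaller x + y. A highest top cell is neither
-- central nor right, since the instance it would belong to has a higher top
-- cell; likewise a rightmost right cell is neither central nor top.

open import Defs
open import Data.Bool using (Bool; true; false; T; T?; not; _∧_)
open import Data.Bool.Properties using (T-∧)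
open import Data.Empty using (⊥-elim)
open import Data.Integer as ℤ using (ℤ; _+_; _-_; 1ℤ; -1ℤ)
import Data.Integer.Properties as ℤₚ
open import Data.List using (List; _∷_; length; filterᵇ)
open import Data.List.Extrema ℤₚ.≤-totalOrder
  using (argmax; argmin; argmax-all; argmin-all; f[xs]≤f[argmax]; f[argmin]≤f[xs])
open import Data.List.Membership.Propositional.Properties
  using (∈-filter⁺; ∈-filter⁻; ∈-length)
open import Data.List.Relation.Unary.All as All using (All)
open import Data.List.Relation.Unary.Any using (here)
open import Data.Nat using (ℕ; _≤_; _<_)
open import Data.Nat.Properties using (≤-trans)
open import Data.Product using (_×_; _,_; proj₁; proj₂; ∃-syntax)
open import Function using (_∘_; id)
open import Function.Bundles using (Equivalence)
open import Relation.Nullary using (¬_)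
open import Relation.Nullary.Decidable using (toWitness)
open import Relation.Binary.PropositionalEquality using (_≡_; refl; sym; trans; subst)

open Equivalence using (to; from)

private variable
  a : Cell
  as : List Cell

i+1-1≡i : ∀ i → i + 1ℤ - 1ℤ ≡ i
i+1-1≡i i = trans (ℤₚ.+-assoc i 1ℤ -1ℤ) (ℤₚ.+-identityʳ i)

i<i+1 : ∀ i → i ℤ.< i + 1ℤ
i<i+1 i = ℤₚ.suc[i]≤j⇒i<j (ℤₚ.≤-reflexive (ℤₚ.+-comm 1ℤ i))

i-1<i : ∀ i → i - 1ℤ ℤ.< i
i-1<i i = ℤₚ.i≤pred[j]⇒i<j (ℤₚ.≤-reflexive (ℤₚ.+-comm i -1ℤ))

T-not⁺ : ∀ {b} → ¬ T b → T (not b)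
T-not⁺ {false} _  = _
T-not⁺ {true}  ¬t = ⊥-elim (¬t _)

∈-nonempty : 0 < length as → ∃[ a ] a ∈ as
∈-nonempty {as = a ∷ _} _ = a , here refl

∃-argmax : (f : Cell → ℤ) → a ∈ as → ∃[ m ] m ∈ as × All (λ b → f b ℤ.≤ f m) as
∃-argmax {a = a} {as} f a∈as =
  argmax f a as , argmax-all f a∈as (All.tabulate id) , f[xs]≤f[argmax] a as

∃-argmin : (f : Cell → ℤ) → a ∈ as → ∃[ m ] m ∈ as × All (λ b → f m ℤ.≤ f b) as
∃-argmin {a = a} {as} f a∈as =
  argmin f a as , argmin-all f a∈as (All.tabulate id) , f[argmin]≤f[xs] a as

∈-filterᵇ-minus : ∀ (p q r : Cell → Bool) as →
                  a ∈ filterᵇ p as → ¬ T (q a) → ¬ T (r a) →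
                  a ∈ filterᵇ (λ b → p b ∧ not (q b) ∧ not (r b)) as
∈-filterᵇ-minus p q r as a∈ ¬qa ¬ra
  with a∈as , pa ← ∈-filter⁻ (T? ∘ p) {xs = as} a∈ =
  ∈-filter⁺ (T? ∘ λ b → p b ∧ not (q b) ∧ not (r b)) a∈as
    (from T-∧ (pa , from T-∧ (T-not⁺ ¬qa , T-not⁺ ¬ra)))

∈ᵇ⇒∈ : ∀ {c cs} → T (c ∈ᵇ cs) → c ∈ cs
∈ᵇ⇒∈ {c} {cs} = toWitness {a? = c ∈? cs}

central-cells : ∀ P {x y} → T (isCentral P (x , y)) →
  (x , y) ∈ cells P × (x + 1ℤ , y) ∈ cells P × (x , y + 1ℤ) ∈ cells P
central-cells P {x} {y} t =
  let (central , right∧top) = to (T-∧ {(x , y) ∈ᵇ cells P}) t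
      (right , top)         = to (T-∧ {(x + 1ℤ , y) ∈ᵇ cells P}) right∧top
  in ∈ᵇ⇒∈ central , ∈ᵇ⇒∈ right , ∈ᵇ⇒∈ top

central∈Xc : ∀ P {x y} → T (isCentral P (x , y)) → (x , y) ∈ Xc P
central∈Xc P t = ∈-filter⁺ (T? ∘ isCentral P) (proj₁ (central-cells P t)) t

central⇒top∈Xt : ∀ P {x y} → T (isCentral P (x , y)) → (x , y + 1ℤ) ∈ Xt P
central⇒top∈Xt P {x} {y} t =
  ∈-filter⁺ (T? ∘ isTop P) (proj₂ (proj₂ (central-cells P t)))
    (subst (λ y′ → T (isCentral P (x , y′))) (sym (i+1-1≡i y)) t)

central⇒right∈Xr : ∀ P {x y} → T (isCentral P (x , y)) → (x + 1ℤ , y) ∈ Xr P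
central⇒right∈Xr P {x} {y} t =
  ∈-filter⁺ (T? ∘ isRight P) (proj₁ (proj₂ (central-cells P t)))
    (subst (λ x′ → T (isCentral P (x′ , y))) (sym (i+1-1≡i x)) t)

antidiagonal : Cell → ℤ
antidiagonal (x , y) = x + y

antidiagonal-minimal-central∈Sc : ∀ P {c} → c ∈ Xc P →
  All (λ b → antidiagonal c ℤ.≤ antidiagonal b) (Xc P) → c ∈ Sc P
antidiagonal-minimal-central∈Sc P {x , y} c∈ minimal =
  ∈-filterᵇ-minus (isCentral P) (isTop P) (isRight P) (cells P) c∈ not-top not-right
  where
  not-top : ¬ T (isTop P (x , y))
  not-top t = ℤₚ.<⇒≱ (ℤₚ.+-monoʳ-< x (i-1<i y)) (All.lookup minimal (central∈Xc P t))

  not-right : ¬ T (isRight P (x , y))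
  not-right t = ℤₚ.<⇒≱ (ℤₚ.+-monoˡ-< y (i-1<i x)) (All.lookup minimal (central∈Xc P t))

highest-top∈St : ∀ P {c} → c ∈ Xt P →
  All (λ b → proj₂ b ℤ.≤ proj₂ c) (Xt P) → c ∈ St P
highest-top∈St P {x , y} c∈ highest =
  ∈-filterᵇ-minus (isTop P) (isRight P) (isCentral P) (cells P) c∈
    no-central-in-row no-central-in-row
  where
  no-central-in-row : ∀ {x′} → ¬ T (isCentral P (x′ , y))
  no-central-in-row t = ℤₚ.<⇒≱ (i<i+1 y) (All.lookup highest (central⇒top∈Xt P t))

rightmost-right∈Sr : ∀ P {c} → c ∈ Xr P →
  All (λ b → proj₁ b ℤ.≤ proj₁ c) (Xr P) → c ∈ Sr P
rightmost-right∈Sr P {x , y} c∈ rightmost =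
  ∈-filterᵇ-minus (isRight P) (isTop P) (isCentral P) (cells P) c∈
    no-central-in-column no-central-in-column
  where
  no-central-in-column : ∀ {y′} → ¬ T (isCentral P (x , y′))
  no-central-in-column t = ℤₚ.<⇒≱ (i<i+1 x) (All.lookup rightmost (central⇒right∈Xr P t))

Sc-nonempty : ∀ P {x y} → T (isCentral P (x , y)) → 1 ≤ length (Sc P)
Sc-nonempty P t =
  let (m , m∈ , minimal) = ∃-argmin antidiagonal (central∈Xc P t)
  in ∈-length (antidiagonal-minimal-central∈Sc P m∈ minimal)

St-nonempty : ∀ P {x y} → T (isCentral P (x , y)) → 1 ≤ length (St P)
St-nonempty P t =
  let (m , m∈ , highest) = ∃-argmax proj₂ (central⇒top∈Xt P t)
  in ∈-length (highest-top∈St P m∈ highest)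

Sr-nonempty : ∀ P {x y} → T (isCentral P (x , y)) → 1 ≤ length (Sr P)
Sr-nonempty P t =
  let (m , m∈ , rightmost) = ∃-argmax proj₁ (central⇒right∈Xr P t)
  in ∈-length (rightmost-right∈Sr P m∈ rightmost)

lemma7p1 : (N : ℕ) → 0 < N → (P : Polyomino) → MinimalFor N P →
    (1 ≤ length (Sc P)) × (1 ≤ length (St P)) × (1 ≤ length (Sr P))
lemma7p1 N 0<N P (N≤instances , _)
  with c , c∈Xc ← ∈-nonempty (≤-trans 0<N N≤instances) =
  let central = proj₂ (∈-filter⁻ (T? ∘ isCentral P) {xs = cells P} c∈Xc)
  in Sc-nonempty P central , St-nonempty P central , Sr-nonempty P central
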